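{- Let $a, b$ be nonzero integers such that $-ab$ is not a perfect square, let $\varepsilon \in \{1, -1\}$, and let $X, Y \in M_2(\mathbb{Z})$. Then $aX^2 + bY^2 = 2\varepsilon I$ and $XY = YX$ if and only if one of the following holds: (i) $X = t_1 I$ and $Y = t_2 I$, where $t_1, t_2 \in \mathbb{Z}$ satisfy $a t_1^2 + b t_2^2 = 2\varepsilon$; (ii) $X = t_1 I$ and $Y = \begin{pmatrix} t_4 & t_2 \\ t_3 & -t_4 \end{pmatrix}$, where $t_1, t_2, t_3, t_4 \in \mathbb{Z}$ satisfy $a t_1^2 + b(t_4^2 + t_2 t_3) = 2\varepsilon$; (iii) $X = \begin{pmatrix} t_1 & \frac{u-2\varepsilon}{g} t_2 \\ \frac{u-2\varepsilon}{g} t_3 & \frac{u t_1 + vb t_4}{2\varepsilon} \end{pmatrix}$ and $Y = \begin{pmatrix} t_4 & \frac{va}{g} t_2 \\ \frac{va}{g} t_3 & \frac{va t_1 - u t_4}{2\varepsilon} \end{pmatrix}$, where $t_1, t_2, t_3, t_4, u, v \in \mathbb{Z}$, $u \neq 2\varepsilon$, $g = \gcd(va, u - 2\varepsilon)$, and $$u^2 + v^2 ab = 4, \qquad a t_1^2 + b t_4^2 + \frac{4a\, t_2 t_3}{g^2}(2 - \varepsilon u) = 2\varepsilon.$$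
   Context: $M_2(\mathbb{Z})$ denotes the ring of $2\times 2$ matrices with integer entries; $I$ is the $2\times 2$ identity matrix. -}

module Defs where

open import Data.Integer using (ℤ; _+_; _*_; -_; 0ℤ; 1ℤ)
open import Data.Product using (∃)
open import Relation.Binary.PropositionalEquality using (_≡_)

record M2 : Set where
  constructor mat
  field
    e₁₁ e₁₂ e₂₁ e₂₂ : ℤ
open M2 public

infixl 7 _*M_ _·M_
infixl 6 _+M_

_*M_ : M2 → M2 → M2
mat a b c d *M mat p q r s =
  mat (a * p + b * r) (a * q + b * s) (c * p + d * r) (c * q + d * s)

_+M_ : M2 → M2 → M2
mat a b c d +M mat p q r s = mat (a + p) (b + q) (c + r) (d + s)

_·M_ : ℤ → M2 → M2
k ·M mat a b c d = mat (k * a) (k * b) (k * c) (k * d)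

I : M2
I = mat 1ℤ 0ℤ 0ℤ 1ℤ

IsPerfectSquare : ℤ → Set
IsPerfectSquare n = ∃ λ k → k * k ≡ n

{-# OPTIONS --safe #-}
module Submission where

open import Defs
open import Data.Integer using (ℤ; _+_; _-_; _*_; -_; 0ℤ; 1ℤ; -1ℤ; +_; ∣_∣; _≟_; ≢-nonZero)
open import Data.Integer.GCD using (gcd; gcd[i,j]≡0⇒j≡0)
open import Data.Integer.Properties
  using (i≡j⇒i-j≡0; i-j≡0⇒i≡j; i*j≡0⇒i≡0∨j≡0; *-zeroʳ; *-identityˡ; *-identityʳ; *-assoc;
         +-comm; *-cancelʳ-≡; -1*i≡-i; +∣i∣≡i⊎+∣i∣≡-i; pos-+; pos-*)
open import Data.Integer.Tactic.RingSolver using (solve)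
import Data.Nat.Base as ℕ
open import Data.Nat.GCD using (module Bézout; gcd-GCD) renaming (gcd to gcdℕ)
open import Data.List.Base using (List; []; _∷_)
open import Data.Product using (_×_; ∃; ∃₂; _,_)
open import Data.Sum using (_⊎_; inj₁; inj₂; [_,_]′)
open import Function.Base using (_∘_)
open import Function.Bundles using (_⇔_; mk⇔)
open import Relation.Binary.PropositionalEquality
  using (_≡_; _≢_; refl; sym; trans; cong; cong₂; subst₂; module ≡-Reasoning)
open import Relation.Nullary using (¬_; yes; no; contradiction)
open import Relation.Nullary.Decidable using (Dec; _×-dec_)

-- If X is not scalar, multiplying a X² + b Y² = 2ε I by adj X and by adj Y and using
-- XY = YX gives the adjugate relations
--   u X + v b Y = 2ε adj X,    v a X − u Y = 2ε adj Y,
-- where u = a det X − b det Y and v is the mixed determinant, det (X + Y) = det X + v + det Y.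
-- Applying adj to the first relation and substituting both gives (u² + v² a b) X = 4 X, so
-- u² + v² a b = 4; and u = 2ε would force v = 0 and X = adj X, i.e. X scalar.  The
-- off-diagonal entries of the second relation say v a · x₁₂ = (u − 2ε) · y₁₂, which Bézout
-- parametrises through g = gcd (v a) (u − 2ε), and the (1,1) entry of the equation becomes
-- the norm constraint.  If X is scalar then Y² is scalar, so Y is traceless or scalar.

infixr 7 _⊛_
infixl 6 _⊕_

_⊛_ : ∀ (c : ℤ) {x y : ℤ} → x ≡ y → c * (x - y) ≡ 0ℤ
c ⊛ x≡y = trans (cong (c *_) (i≡j⇒i-j≡0 x≡y)) (*-zeroʳ c)

_⊕_ : ∀ {x y : ℤ} → x ≡ 0ℤ → y ≡ 0ℤ → x + y ≡ 0ℤ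
refl ⊕ refl = refl

linear-combination : ∀ {x y s : ℤ} → s ≡ 0ℤ → x - y ≡ s → x ≡ y
linear-combination {x} {y} refl x-y≡0 = i-j≡0⇒i≡j x y x-y≡0

linear-combination-scaled : ∀ {k x y s : ℤ} → k ≢ 0ℤ → s ≡ 0ℤ → k * (x - y) ≡ s → x ≡ y
linear-combination-scaled {k} {x} {y} k≢0 refl k[x-y]≡0 with i*j≡0⇒i≡0∨j≡0 k k[x-y]≡0
... | inj₁ k≡0   = contradiction k≡0 k≢0
... | inj₂ x-y≡0 = i-j≡0⇒i≡j x y x-y≡0

O : M2
O = mat 0ℤ 0ℤ 0ℤ 0ℤ

trace : M2 → ℤ
trace (mat a _ _ d) = a + d

det : M2 → ℤ
det (mat a b c d) = a * d - b * c

-- det (X + Y) = det X + mixedDet X Y + det Y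
mixedDet : M2 → M2 → ℤ
mixedDet (mat a b c d) (mat p q r s) = a * s + d * p - b * r - c * q

*-≢0 : ∀ {i j : ℤ} → i ≢ 0ℤ → j ≢ 0ℤ → i * j ≢ 0ℤ
*-≢0 {i} i≢0 j≢0 i*j≡0 with i*j≡0⇒i≡0∨j≡0 i i*j≡0
... | inj₁ i≡0 = i≢0 i≡0
... | inj₂ j≡0 = j≢0 j≡0

i*i≡0⇒i≡0 : ∀ {i : ℤ} → i * i ≡ 0ℤ → i ≡ 0ℤ
i*i≡0⇒i≡0 {i} i*i≡0 with i*j≡0⇒i≡0∨j≡0 i i*i≡0
... | inj₁ i≡0 = i≡0
... | inj₂ i≡0 = i≡0

±1⇒unit : ∀ {ε : ℤ} → ε ≡ 1ℤ ⊎ ε ≡ -1ℤ → ε * ε ≡ 1ℤ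
±1⇒unit (inj₁ refl) = refl
±1⇒unit (inj₂ refl) = refl

unit⇒≢0 : ∀ {ε : ℤ} → ε * ε ≡ 1ℤ → ε ≢ 0ℤ
unit⇒≢0 () refl

+∣i∣≡±i : ∀ i → ∃ λ s → + ∣ i ∣ ≡ s * i
+∣i∣≡±i i with +∣i∣≡i⊎+∣i∣≡-i i
... | inj₁ +∣i∣≡i  = 1ℤ , trans +∣i∣≡i (sym (*-identityˡ i))
... | inj₂ +∣i∣≡-i = -1ℤ , trans +∣i∣≡-i (sym (-1*i≡-i i))

pos-≡ : ∀ (d x y m n : ℕ.ℕ) → d ℕ.+ y ℕ.* n ≡ x ℕ.* m → + d + + y * + n ≡ + x * + m
pos-≡ d x y m n eq = begin
  + d + + y * + n   ≡⟨ cong (λ z → + d + z) (pos-* y n) ⟨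
  + d + + (y ℕ.* n) ≡⟨ pos-+ d (y ℕ.* n) ⟨
  + (d ℕ.+ y ℕ.* n) ≡⟨ cong +_ eq ⟩
  + (x ℕ.* m)       ≡⟨ pos-* x m ⟩
  + x * + m         ∎
  where open ≡-Reasoning

move-right : ∀ d x y m n → d + y * n ≡ x * m → d ≡ x * m + - y * n
move-right d x y m n eq = linear-combination (1ℤ ⊛ eq) (solve (d ∷ x ∷ y ∷ m ∷ n ∷ []))

pos-bezout : ∀ m n → ∃₂ λ x y → + gcdℕ m n ≡ x * + m + y * + n
pos-bezout m n with Bézout.identity (gcd-GCD m n)
... | Bézout.+- x y eq = + x , - + y ,
  move-right (+ gcdℕ m n) (+ x) (+ y) (+ m) (+ n) (pos-≡ (gcdℕ m n) x y m n eq)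
... | Bézout.-+ x y eq = - + x , + y ,
  trans (move-right (+ gcdℕ m n) (+ y) (+ x) (+ n) (+ m) (pos-≡ (gcdℕ m n) y x n m eq))
        (+-comm (+ y * + n) (- + x * + m))

gcd-bezout : ∀ m n → ∃₂ λ x y → gcd m n ≡ x * m + y * n
gcd-bezout m n with pos-bezout ∣ m ∣ ∣ n ∣ | +∣i∣≡±i m | +∣i∣≡±i n
... | x , y , eq | s , ∣m∣≡sm | t , ∣n∣≡tn = x * s , y * t , (begin
  gcd m n                   ≡⟨ eq ⟩
  x * + ∣ m ∣ + y * + ∣ n ∣ ≡⟨ cong₂ (λ i j → x * i + y * j) ∣m∣≡sm ∣n∣≡tn ⟩
  x * (s * m) + y * (t * n) ≡⟨ cong₂ _+_ (*-assoc x s m) (*-assoc y t n) ⟨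
  x * s * m + y * t * n     ∎)
  where open ≡-Reasoning

bezout-split : ∀ {g m n x y p q : ℤ} → g ≡ p * m + q * n → m * x ≡ n * y →
               g * x ≡ n * (p * y + q * x) × g * y ≡ m * (p * y + q * x)
bezout-split {g} {m} {n} {x} {y} {p} {q} g≡pm+qn mx≡ny =
  linear-combination (x ⊛ g≡pm+qn ⊕ p ⊛ mx≡ny) (solve (g ∷ m ∷ n ∷ x ∷ y ∷ p ∷ q ∷ [])) ,
  linear-combination (y ⊛ g≡pm+qn ⊕ (- q) ⊛ mx≡ny) (solve (g ∷ m ∷ n ∷ x ∷ y ∷ p ∷ q ∷ []))

gcd-split : ∀ m n {x y} → m * x ≡ n * y → ∃ λ t → gcd m n * x ≡ n * t × gcd m n * y ≡ m * t
gcd-split m n {x} {y} mx≡ny with gcd-bezout m n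
... | p , q , g≡pm+qn = p * y + q * x , bezout-split {m = m} {n} {p = p} {q} g≡pm+qn mx≡ny

mat-cong : ∀ {a b c d p q r s} → a ≡ p → b ≡ q → c ≡ r → d ≡ s → mat a b c d ≡ mat p q r s
mat-cong refl refl refl refl = refl

-- The ring solver only sees literal polynomials, hence these entrywise forms; they are stated
-- exactly as the matrix operations compute them, so the conversions below are definitional.
EquationEntries : (a b ε : ℤ) (X Y : M2) → Set
EquationEntries a b ε (mat A B C D) (mat E F G H) =
    a * (A * A + B * C) + b * (E * E + F * G) ≡ + 2 * ε * 1ℤ
  × a * (A * B + B * D) + b * (E * F + F * H) ≡ + 2 * ε * 0ℤ
  × a * (C * A + D * C) + b * (G * E + H * G) ≡ + 2 * ε * 0ℤ
  × a * (C * B + D * D) + b * (G * F + H * H) ≡ + 2 * ε * 1ℤ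

CommutationEntries : (X Y : M2) → Set
CommutationEntries (mat A B C D) (mat E F G H) =
    A * E + B * G ≡ E * A + F * C
  × A * F + B * H ≡ E * B + F * D
  × C * E + D * G ≡ G * A + H * C
  × C * F + D * H ≡ G * B + H * D

equation⇒entries : ∀ {a b ε} X Y →
  a ·M (X *M X) +M b ·M (Y *M Y) ≡ (+ 2 * ε) ·M I → EquationEntries a b ε X Y
equation⇒entries (mat _ _ _ _) (mat _ _ _ _) eq = cong e₁₁ eq , cong e₁₂ eq , cong e₂₁ eq , cong e₂₂ eq

entries⇒equation : ∀ {a b ε} X Y →
  EquationEntries a b ε X Y → a ·M (X *M X) +M b ·M (Y *M Y) ≡ (+ 2 * ε) ·M I
entries⇒equation (mat _ _ _ _) (mat _ _ _ _) (h₁₁ , h₁₂ , h₂₁ , h₂₂) = mat-cong h₁₁ h₁₂ h₂₁ h₂₂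

commute⇒entries : ∀ X Y → X *M Y ≡ Y *M X → CommutationEntries X Y
commute⇒entries (mat _ _ _ _) (mat _ _ _ _) com = cong e₁₁ com , cong e₁₂ com , cong e₂₁ com , cong e₂₂ com

entries⇒commute : ∀ X Y → CommutationEntries X Y → X *M Y ≡ Y *M X
entries⇒commute (mat _ _ _ _) (mat _ _ _ _) (c₁₁ , c₁₂ , c₂₁ , c₂₂) = mat-cong c₁₁ c₁₂ c₂₁ c₂₂

IsScalar : M2 → Set
IsScalar (mat a b c d) = b ≡ 0ℤ × c ≡ 0ℤ × a ≡ d

isScalar? : ∀ X → Dec (IsScalar X)
isScalar? (mat a b c d) = b ≟ 0ℤ ×-dec c ≟ 0ℤ ×-dec a ≟ d

nonscalar⇒≢O : ∀ {X} → ¬ IsScalar X → X ≢ O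
nonscalar⇒≢O X-nonscalar refl = X-nonscalar (refl , refl , refl)

scalar-matrix : ∀ t → mat t 0ℤ 0ℤ t ≡ t ·M I
scalar-matrix t = mat-cong (sym (*-identityʳ t)) (sym (*-zeroʳ t)) (sym (*-zeroʳ t)) (sym (*-identityʳ t))

scalar-commutes : ∀ t X → CommutationEntries (mat t 0ℤ 0ℤ t) X
scalar-commutes t (mat a b c d) =
  solve (t ∷ a ∷ b ∷ c ∷ d ∷ []) , solve (t ∷ a ∷ b ∷ c ∷ d ∷ []) ,
  solve (t ∷ a ∷ b ∷ c ∷ d ∷ []) , solve (t ∷ a ∷ b ∷ c ∷ d ∷ [])

·M-cancelʳ : ∀ {k l X} → X ≢ O → k ·M X ≡ l ·M X → k ≡ l
·M-cancelʳ {k} {l} {mat a b c d} X≢O kX≡lX with a ≟ 0ℤ | b ≟ 0ℤ | c ≟ 0ℤ | d ≟ 0ℤ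
... | no a≢0   | _        | _        | _        = *-cancelʳ-≡ k l a {{≢-nonZero a≢0}} (cong e₁₁ kX≡lX)
... | _        | no b≢0   | _        | _        = *-cancelʳ-≡ k l b {{≢-nonZero b≢0}} (cong e₁₂ kX≡lX)
... | _        | _        | no c≢0   | _        = *-cancelʳ-≡ k l c {{≢-nonZero c≢0}} (cong e₂₁ kX≡lX)
... | _        | _        | _        | no d≢0   = *-cancelʳ-≡ k l d {{≢-nonZero d≢0}} (cong e₂₂ kX≡lX)
... | yes refl | yes refl | yes refl | yes refl = contradiction refl X≢O

square-scalar⇒scalar : ∀ Y → trace Y ≢ 0ℤ → IsScalar (Y *M Y) → IsScalar Y
square-scalar⇒scalar (mat a b c d) tr≢0 (b′≡0 , c′≡0 , a′≡d′) =
  linear-combination-scaled {a + d} tr≢0 (1ℤ ⊛ ab+bd≡0) (solve (a ∷ b ∷ c ∷ d ∷ [])) ,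
  linear-combination-scaled {a + d} tr≢0 (1ℤ ⊛ ca+dc≡0) (solve (a ∷ b ∷ c ∷ d ∷ [])) ,
  linear-combination-scaled {a + d} tr≢0 (1ℤ ⊛ diagonal) (solve (a ∷ b ∷ c ∷ d ∷ []))
  where
  ab+bd≡0 : a * b + b * d ≡ 0ℤ
  ab+bd≡0 = b′≡0
  ca+dc≡0 : c * a + d * c ≡ 0ℤ
  ca+dc≡0 = c′≡0
  diagonal : a * a + b * c ≡ c * b + d * d
  diagonal = a′≡d′

Solution : (a b ε : ℤ) (X Y : M2) → Set
Solution a b ε X Y = (a ·M (X *M X) +M b ·M (Y *M Y) ≡ (+ 2 * ε) ·M I) × (X *M Y ≡ Y *M X)

BothScalar : (a b ε : ℤ) (X Y : M2) → Set
BothScalar a b ε X Y = ∃ λ t₁ → ∃ λ t₂ →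
  X ≡ t₁ ·M I × Y ≡ t₂ ·M I × a * t₁ * t₁ + b * t₂ * t₂ ≡ + 2 * ε

ScalarTraceless : (a b ε : ℤ) (X Y : M2) → Set
ScalarTraceless a b ε X Y = ∃ λ t₁ → ∃ λ t₂ → ∃ λ t₃ → ∃ λ t₄ →
  X ≡ t₁ ·M I × Y ≡ mat t₄ t₂ t₃ (- t₄) × a * t₁ * t₁ + b * (t₄ * t₄ + t₂ * t₃) ≡ + 2 * ε

NormConstraint : (a b ε g u t₁ t₂ t₃ t₄ : ℤ) → Set
NormConstraint a b ε g u t₁ t₂ t₃ t₄ =
  g * g * (a * t₁ * t₁ + b * t₄ * t₄) + + 4 * a * t₂ * t₃ * (+ 2 - ε * u) ≡ + 2 * ε * (g * g)

ParametrisedBy : (a b ε g u v t₁ t₂ t₃ t₄ : ℤ) (X Y : M2) → Set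
ParametrisedBy a b ε g u v t₁ t₂ t₃ t₄ X Y =
  e₁₁ X ≡ t₁ × g * e₁₂ X ≡ (u - + 2 * ε) * t₂ × g * e₂₁ X ≡ (u - + 2 * ε) * t₃
  × + 2 * ε * e₂₂ X ≡ u * t₁ + v * b * t₄
  × e₁₁ Y ≡ t₄ × g * e₁₂ Y ≡ v * a * t₂ × g * e₂₁ Y ≡ v * a * t₃
  × + 2 * ε * e₂₂ Y ≡ v * a * t₁ - u * t₄

Parametrised : (a b ε : ℤ) (X Y : M2) → Set
Parametrised a b ε X Y = ∃ λ t₁ → ∃ λ t₂ → ∃ λ t₃ → ∃ λ t₄ → ∃ λ u → ∃ λ v →
  u ≢ + 2 * ε × u * u + v * v * a * b ≡ + 4
  × NormConstraint a b ε (gcd (v * a) (u - + 2 * ε)) u t₁ t₂ t₃ t₄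
  × ParametrisedBy a b ε (gcd (v * a) (u - + 2 * ε)) u v t₁ t₂ t₃ t₄ X Y

Cases : (a b ε : ℤ) (X Y : M2) → Set
Cases a b ε X Y = BothScalar a b ε X Y ⊎ ScalarTraceless a b ε X Y ⊎ Parametrised a b ε X Y

-- Solutions with X not scalar

AdjugateRelations : (a b ε u v : ℤ) (X Y : M2) → Set
AdjugateRelations a b ε u v (mat A B C D) (mat E F G H) =
    u * A + v * b * E ≡ + 2 * ε * D
  × u * B + v * b * F ≡ + 2 * ε * (- B)
  × u * C + v * b * G ≡ + 2 * ε * (- C)
  × u * D + v * b * H ≡ + 2 * ε * A
  × v * a * A - u * E ≡ + 2 * ε * H
  × v * a * B - u * F ≡ + 2 * ε * (- F)
  × v * a * C - u * G ≡ + 2 * ε * (- G)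
  × v * a * D - u * H ≡ + 2 * ε * E

solution⇒adjugate-relations : ∀ {a b ε} X Y → EquationEntries a b ε X Y → CommutationEntries X Y →
  AdjugateRelations a b ε (a * det X - b * det Y) (mixedDet X Y) X Y
solution⇒adjugate-relations {a} {b} {ε} (mat A B C D) (mat E F G H)
  (h₁₁ , h₁₂ , h₂₁ , h₂₂) (c₁₁ , c₁₂ , c₂₁ , c₂₂) = relations
  where
  vars : List ℤ
  vars = a ∷ b ∷ ε ∷ A ∷ B ∷ C ∷ D ∷ E ∷ F ∷ G ∷ H ∷ []
  relations : AdjugateRelations a b ε (a * (A * D - B * C) - b * (E * H - F * G)) (A * H + D * E - B * G - C * F)
                (mat A B C D) (mat E F G H)
  relations =
    linear-combination (D ⊛ h₁₁ ⊕ (- B) ⊛ h₂₁ ⊕ (b * E) ⊛ c₁₁ ⊕ (b * G) ⊛ c₁₂) (solve vars) ,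
    linear-combination (D ⊛ h₁₂ ⊕ (- B) ⊛ h₂₂ ⊕ (b * F) ⊛ c₁₁ ⊕ (b * H) ⊛ c₁₂) (solve vars) ,
    linear-combination ((- C) ⊛ h₁₁ ⊕ A ⊛ h₂₁ ⊕ (b * E) ⊛ c₂₁ ⊕ (b * G) ⊛ c₂₂) (solve vars) ,
    linear-combination ((- C) ⊛ h₁₂ ⊕ A ⊛ h₂₂ ⊕ (b * F) ⊛ c₂₁ ⊕ (b * H) ⊛ c₂₂) (solve vars) ,
    linear-combination (H ⊛ h₁₁ ⊕ (- F) ⊛ h₂₁ ⊕ (- (a * A)) ⊛ c₁₁ ⊕ (- (a * C)) ⊛ c₁₂) (solve vars) ,
    linear-combination (H ⊛ h₁₂ ⊕ (- F) ⊛ h₂₂ ⊕ (- (a * B)) ⊛ c₁₁ ⊕ (- (a * D)) ⊛ c₁₂) (solve vars) ,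
    linear-combination ((- G) ⊛ h₁₁ ⊕ E ⊛ h₂₁ ⊕ (- (a * A)) ⊛ c₂₁ ⊕ (- (a * C)) ⊛ c₂₂) (solve vars) ,
    linear-combination ((- G) ⊛ h₁₂ ⊕ E ⊛ h₂₂ ⊕ (- (a * B)) ⊛ c₂₁ ⊕ (- (a * D)) ⊛ c₂₂) (solve vars)

adjugate-relations⇒norm : ∀ {a b ε u v} X Y → ε * ε ≡ 1ℤ → AdjugateRelations a b ε u v X Y →
  (u * u + v * v * a * b) ·M X ≡ + 4 ·M X
adjugate-relations⇒norm {a} {b} {ε} {u} {v} (mat A B C D) (mat E F G H) unit
  (x₁₁ , x₁₂ , x₂₁ , x₂₂ , y₁₁ , y₁₂ , y₂₁ , y₂₂) =
  mat-cong
    (linear-combination (u ⊛ x₁₁ ⊕ (v * b) ⊛ y₁₁ ⊕ (+ 2 * ε) ⊛ x₂₂ ⊕ (+ 4 * A) ⊛ unit) (solve vars))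
    (linear-combination ((u - + 2 * ε) ⊛ x₁₂ ⊕ (v * b) ⊛ y₁₂ ⊕ (+ 4 * B) ⊛ unit) (solve vars))
    (linear-combination ((u - + 2 * ε) ⊛ x₂₁ ⊕ (v * b) ⊛ y₂₁ ⊕ (+ 4 * C) ⊛ unit) (solve vars))
    (linear-combination (u ⊛ x₂₂ ⊕ (v * b) ⊛ y₂₂ ⊕ (+ 2 * ε) ⊛ x₁₁ ⊕ (+ 4 * D) ⊛ unit) (solve vars))
  where
  vars : List ℤ
  vars = a ∷ b ∷ ε ∷ u ∷ v ∷ A ∷ B ∷ C ∷ D ∷ E ∷ F ∷ G ∷ H ∷ []

adjugate-relations⇒scalar : ∀ {a b ε u v} X Y → a ≢ 0ℤ → b ≢ 0ℤ → ε * ε ≡ 1ℤ →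
  u * u + v * v * a * b ≡ + 4 → AdjugateRelations a b ε u v X Y → u ≡ + 2 * ε → IsScalar X
adjugate-relations⇒scalar {a} {b} {ε} {u} {v} (mat A B C D) (mat E F G H) a≢0 b≢0 unit norm
  (x₁₁ , x₁₂ , x₂₁ , _) u≡2ε =
  linear-combination-scaled 4ε≢0 (1ℤ ⊛ x₁₂ ⊕ (- B) ⊛ u≡2ε ⊕ (- (b * F)) ⊛ v≡0) (solve vars) ,
  linear-combination-scaled 4ε≢0 (1ℤ ⊛ x₂₁ ⊕ (- C) ⊛ u≡2ε ⊕ (- (b * G)) ⊛ v≡0) (solve vars) ,
  linear-combination-scaled 2ε≢0 (1ℤ ⊛ x₁₁ ⊕ (- A) ⊛ u≡2ε ⊕ (- (b * E)) ⊛ v≡0) (solve vars)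
  where
  vars : List ℤ
  vars = a ∷ b ∷ ε ∷ u ∷ v ∷ A ∷ B ∷ C ∷ D ∷ E ∷ F ∷ G ∷ H ∷ []
  2ε≢0 : + 2 * ε ≢ 0ℤ
  2ε≢0 = *-≢0 {+ 2} (λ ()) (unit⇒≢0 unit)
  4ε≢0 : + 4 * ε ≢ 0ℤ
  4ε≢0 = *-≢0 {+ 4} (λ ()) (unit⇒≢0 unit)
  v≡0 : v ≡ 0ℤ
  v≡0 = i*i≡0⇒i≡0 (linear-combination-scaled (*-≢0 a≢0 b≢0)
          (1ℤ ⊛ norm ⊕ (- (u + + 2 * ε)) ⊛ u≡2ε ⊕ (- + 4) ⊛ unit) (solve vars))

norm-constraint : ∀ {a b ε u v g t₂ t₃} X Y → ε * ε ≡ 1ℤ → u * u + v * v * a * b ≡ + 4 →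
  EquationEntries a b ε X Y →
  g * e₁₂ X ≡ (u - + 2 * ε) * t₂ → g * e₂₁ X ≡ (u - + 2 * ε) * t₃ →
  g * e₁₂ Y ≡ v * a * t₂ → g * e₂₁ Y ≡ v * a * t₃ →
  NormConstraint a b ε g u (e₁₁ X) t₂ t₃ (e₁₁ Y)
norm-constraint {a} {b} {ε} {u} {v} {g} {t₂} {t₃} (mat A B C D) (mat E F G H) unit norm
  (h₁₁ , _) gB gC gF gG =
  linear-combination
    ((g * g) ⊛ h₁₁ ⊕ (- (a * (g * C))) ⊛ gB ⊕ (- (a * ((u - + 2 * ε) * t₂))) ⊛ gC
     ⊕ (- (b * (g * G))) ⊛ gF ⊕ (- (b * (v * a * t₂))) ⊛ gG
     ⊕ (- (a * t₂ * t₃)) ⊛ norm ⊕ (- (+ 4 * a * t₂ * t₃)) ⊛ unit)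
    (solve (a ∷ b ∷ ε ∷ u ∷ v ∷ g ∷ t₂ ∷ t₃ ∷ A ∷ B ∷ C ∷ D ∷ E ∷ F ∷ G ∷ H ∷ []))

adjugate-relations⇒parametrised : ∀ {a b ε u v} X Y → ε * ε ≡ 1ℤ → u ≢ + 2 * ε →
  u * u + v * v * a * b ≡ + 4 → EquationEntries a b ε X Y →
  AdjugateRelations a b ε u v X Y → Parametrised a b ε X Y
adjugate-relations⇒parametrised {a} {b} {ε} {u} {v} (mat A B C D) (mat E F G H) unit u≢2ε norm eq
  (x₁₁ , _ , _ , _ , y₁₁ , y₁₂ , y₂₁ , _) =
  let t₂ , gB , gF = gcd-split (v * a) (u - + 2 * ε) {B} {F} B-proportional
      t₃ , gC , gG = gcd-split (v * a) (u - + 2 * ε) {C} {G} C-proportional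
  in  A , t₂ , t₃ , E , u , v , u≢2ε , norm ,
      norm-constraint {a} {b} {ε} {u} {v} {gcd (v * a) (u - + 2 * ε)} {t₂} {t₃} (mat A B C D) (mat E F G H)
        unit norm eq gB gC gF gG ,
      refl , gB , gC , sym x₁₁ , refl , gF , gG , H-entry
  where
  vars : List ℤ
  vars = a ∷ b ∷ ε ∷ u ∷ v ∷ A ∷ B ∷ C ∷ E ∷ F ∷ G ∷ H ∷ []
  B-proportional : v * a * B ≡ (u - + 2 * ε) * F
  B-proportional = linear-combination (1ℤ ⊛ y₁₂) (solve vars)
  C-proportional : v * a * C ≡ (u - + 2 * ε) * G
  C-proportional = linear-combination (1ℤ ⊛ y₂₁) (solve vars)
  H-entry : + 2 * ε * H ≡ v * a * A - u * E
  H-entry = sym y₁₁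

nonscalar-solution⇒parametrised : ∀ {a b ε} X Y → a ≢ 0ℤ → b ≢ 0ℤ → ε * ε ≡ 1ℤ →
  EquationEntries a b ε X Y → CommutationEntries X Y → ¬ IsScalar X → Parametrised a b ε X Y
nonscalar-solution⇒parametrised {a} {b} {ε} X Y a≢0 b≢0 unit eq com X-nonscalar =
  adjugate-relations⇒parametrised {a} {b} {ε} {u} {v} X Y unit u≢2ε norm eq relations
  where
  u v : ℤ
  u = a * det X - b * det Y
  v = mixedDet X Y
  relations : AdjugateRelations a b ε u v X Y
  relations = solution⇒adjugate-relations {a} {b} {ε} X Y eq com
  norm : u * u + v * v * a * b ≡ + 4
  norm = ·M-cancelʳ (nonscalar⇒≢O X-nonscalar)
           (adjugate-relations⇒norm {a} {b} {ε} {u} {v} X Y unit relations)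
  u≢2ε : u ≢ + 2 * ε
  u≢2ε u≡2ε =
    X-nonscalar (adjugate-relations⇒scalar {a} {b} {ε} {u} {v} X Y a≢0 b≢0 unit norm relations u≡2ε)

-- Solutions with X scalar

scalar-solution⇒square-scalar : ∀ {a b ε} X Y → b ≢ 0ℤ → IsScalar X →
  EquationEntries a b ε X Y → IsScalar (Y *M Y)
scalar-solution⇒square-scalar {a} {b} {ε} (mat A B C D) (mat E F G H) b≢0 (refl , refl , refl)
  (h₁₁ , h₁₂ , h₂₁ , h₂₂) = EF+FH≡0 , GE+HG≡0 , diagonal
  where
  vars : List ℤ
  vars = a ∷ b ∷ ε ∷ A ∷ D ∷ E ∷ F ∷ G ∷ H ∷ []
  EF+FH≡0 : E * F + F * H ≡ 0ℤ
  EF+FH≡0 = linear-combination-scaled b≢0 (1ℤ ⊛ h₁₂) (solve vars)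
  GE+HG≡0 : G * E + H * G ≡ 0ℤ
  GE+HG≡0 = linear-combination-scaled b≢0 (1ℤ ⊛ h₂₁) (solve vars)
  diagonal : E * E + F * G ≡ G * F + H * H
  diagonal = linear-combination-scaled b≢0 (1ℤ ⊛ h₁₁ ⊕ -1ℤ ⊛ h₂₂) (solve vars)

scalar-traceless-case : ∀ {a b ε} X Y → IsScalar X → trace Y ≡ 0ℤ →
  EquationEntries a b ε X Y → ScalarTraceless a b ε X Y
scalar-traceless-case {a} {b} {ε} (mat A B C D) (mat E F G H) (refl , refl , refl) trace≡0 (h₁₁ , _) =
  A , F , G , E , scalar-matrix A ,
  cong (mat E F G) (linear-combination (1ℤ ⊛ E+H≡0) (solve vars)) ,
  linear-combination (1ℤ ⊛ h₁₁) (solve vars)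
  where
  vars : List ℤ
  vars = a ∷ b ∷ ε ∷ A ∷ D ∷ E ∷ F ∷ G ∷ H ∷ []
  E+H≡0 : E + H ≡ 0ℤ
  E+H≡0 = trace≡0

both-scalar-case : ∀ {a b ε} X Y → IsScalar X → IsScalar Y →
  EquationEntries a b ε X Y → BothScalar a b ε X Y
both-scalar-case {a} {b} {ε} (mat A B C D) (mat E F G H) (refl , refl , refl) (refl , refl , refl) (h₁₁ , _) =
  A , E , scalar-matrix A , scalar-matrix E ,
  linear-combination (1ℤ ⊛ h₁₁) (solve (a ∷ b ∷ ε ∷ A ∷ D ∷ E ∷ H ∷ []))

scalar-solution⇒cases : ∀ {a b ε} X Y → b ≢ 0ℤ → IsScalar X → EquationEntries a b ε X Y →
  BothScalar a b ε X Y ⊎ ScalarTraceless a b ε X Y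
scalar-solution⇒cases {a} {b} {ε} X Y b≢0 X-scalar eq with trace Y ≟ 0ℤ
... | yes trace≡0 = inj₂ (scalar-traceless-case {a} {b} {ε} X Y X-scalar trace≡0 eq)
... | no trace≢0  = inj₁ (both-scalar-case {a} {b} {ε} X Y X-scalar Y-scalar eq)
  where
  Y-scalar : IsScalar Y
  Y-scalar = square-scalar⇒scalar Y trace≢0
               (scalar-solution⇒square-scalar {a} {b} {ε} X Y b≢0 X-scalar eq)

solution⇒cases : ∀ {a b ε} X Y → a ≢ 0ℤ → b ≢ 0ℤ → ε * ε ≡ 1ℤ → Solution a b ε X Y → Cases a b ε X Y
solution⇒cases {a} {b} {ε} X Y a≢0 b≢0 unit (eq , com) with isScalar? X
... | yes X-scalar    =
  [ inj₁ , inj₂ ∘ inj₁ ]′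
    (scalar-solution⇒cases {a} {b} {ε} X Y b≢0 X-scalar (equation⇒entries {a} {b} {ε} X Y eq))
... | no X-nonscalar =
  inj₂ (inj₂ (nonscalar-solution⇒parametrised {a} {b} {ε} X Y a≢0 b≢0 unit
                (equation⇒entries {a} {b} {ε} X Y eq) (commute⇒entries X Y com) X-nonscalar))

-- The converse

both-scalar-solution : ∀ {a b ε t₁ t₂} → a * t₁ * t₁ + b * t₂ * t₂ ≡ + 2 * ε →
  Solution a b ε (t₁ ·M I) (t₂ ·M I)
both-scalar-solution {a} {b} {ε} {t₁} {t₂} eq =
  subst₂ (Solution a b ε) (scalar-matrix t₁) (scalar-matrix t₂)
    (entries⇒equation {a} {b} {ε} (mat t₁ 0ℤ 0ℤ t₁) (mat t₂ 0ℤ 0ℤ t₂)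
       (linear-combination (1ℤ ⊛ eq) (solve vars) , solve vars ,
        solve vars , linear-combination (1ℤ ⊛ eq) (solve vars)) ,
     entries⇒commute (mat t₁ 0ℤ 0ℤ t₁) (mat t₂ 0ℤ 0ℤ t₂) (scalar-commutes t₁ (mat t₂ 0ℤ 0ℤ t₂)))
  where
  vars : List ℤ
  vars = a ∷ b ∷ ε ∷ t₁ ∷ t₂ ∷ []

scalar-traceless-solution : ∀ {a b ε t₁ t₂ t₃ t₄} → a * t₁ * t₁ + b * (t₄ * t₄ + t₂ * t₃) ≡ + 2 * ε →
  Solution a b ε (t₁ ·M I) (mat t₄ t₂ t₃ (- t₄))
scalar-traceless-solution {a} {b} {ε} {t₁} {t₂} {t₃} {t₄} eq =
  subst₂ (Solution a b ε) (scalar-matrix t₁) refl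
    (entries⇒equation {a} {b} {ε} (mat t₁ 0ℤ 0ℤ t₁) (mat t₄ t₂ t₃ (- t₄))
       (linear-combination (1ℤ ⊛ eq) (solve vars) , solve vars ,
        solve vars , linear-combination (1ℤ ⊛ eq) (solve vars)) ,
     entries⇒commute (mat t₁ 0ℤ 0ℤ t₁) (mat t₄ t₂ t₃ (- t₄)) (scalar-commutes t₁ (mat t₄ t₂ t₃ (- t₄))))
  where
  vars : List ℤ
  vars = a ∷ b ∷ ε ∷ t₁ ∷ t₂ ∷ t₃ ∷ t₄ ∷ []

-- Only g x₁₂, 2ε x₂₂, g y₁₂, … are prescribed, so each entry identity is checked after
-- multiplying it by g², 2εg or (2ε)².
parametrised⇒equation : ∀ {a b ε g u v t₁ t₂ t₃ t₄} X Y → g ≢ 0ℤ → ε * ε ≡ 1ℤ →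
  u * u + v * v * a * b ≡ + 4 → NormConstraint a b ε g u t₁ t₂ t₃ t₄ →
  ParametrisedBy a b ε g u v t₁ t₂ t₃ t₄ X Y → EquationEntries a b ε X Y
parametrised⇒equation {a} {b} {ε} {g} {u} {v} {t₁} {t₂} {t₃} {t₄} (mat A B C D) (mat E F G H)
  g≢0 unit norm constraint (refl , gB , gC , 2εD , refl , gF , gG , 2εH) =
  h₁₁ ,
  linear-combination-scaled 2εg≢0
    ((a * (+ 2 * ε * t₁ + + 2 * ε * D)) ⊛ gB ⊕ (a * ((u - + 2 * ε) * t₂)) ⊛ 2εD
     ⊕ (b * (+ 2 * ε * t₄ + + 2 * ε * H)) ⊛ gF ⊕ (b * (v * a * t₂)) ⊛ 2εH
     ⊕ (a * t₁ * t₂) ⊛ norm ⊕ (- (+ 4 * a * t₁ * t₂)) ⊛ unit)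
    (solve vars) ,
  linear-combination-scaled 2εg≢0
    ((a * (+ 2 * ε * t₁ + + 2 * ε * D)) ⊛ gC ⊕ (a * ((u - + 2 * ε) * t₃)) ⊛ 2εD
     ⊕ (b * (+ 2 * ε * t₄ + + 2 * ε * H)) ⊛ gG ⊕ (b * (v * a * t₃)) ⊛ 2εH
     ⊕ (a * t₁ * t₃) ⊛ norm ⊕ (- (+ 4 * a * t₁ * t₃)) ⊛ unit)
    (solve vars) ,
  linear-combination (1ℤ ⊛ h₁₁ ⊕ 1ℤ ⊛ diagonal) (solve vars)
  where
  vars : List ℤ
  vars = a ∷ b ∷ ε ∷ g ∷ u ∷ v ∷ t₁ ∷ t₂ ∷ t₃ ∷ t₄ ∷ B ∷ C ∷ D ∷ F ∷ G ∷ H ∷ []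
  2ε≢0 : + 2 * ε ≢ 0ℤ
  2ε≢0 = *-≢0 {+ 2} (λ ()) (unit⇒≢0 unit)
  2εg≢0 : + 2 * ε * g ≢ 0ℤ
  2εg≢0 = *-≢0 2ε≢0 g≢0
  h₁₁ : a * (t₁ * t₁ + B * C) + b * (t₄ * t₄ + F * G) ≡ + 2 * ε * 1ℤ
  h₁₁ = linear-combination-scaled (*-≢0 g≢0 g≢0)
    (1ℤ ⊛ constraint ⊕ (a * (g * C)) ⊛ gB ⊕ (a * ((u - + 2 * ε) * t₂)) ⊛ gC
     ⊕ (b * (g * G)) ⊛ gF ⊕ (b * (v * a * t₂)) ⊛ gG
     ⊕ (a * t₂ * t₃) ⊛ norm ⊕ (+ 4 * a * t₂ * t₃) ⊛ unit)
    (solve vars)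
  diagonal : a * D * D + b * H * H ≡ a * t₁ * t₁ + b * t₄ * t₄
  diagonal = linear-combination-scaled (*-≢0 2ε≢0 2ε≢0)
    ((a * (+ 2 * ε * D + (u * t₁ + v * b * t₄))) ⊛ 2εD ⊕ (b * (+ 2 * ε * H + (v * a * t₁ - u * t₄))) ⊛ 2εH
     ⊕ (a * t₁ * t₁ + b * t₄ * t₄) ⊛ norm ⊕ (- (+ 4 * (a * t₁ * t₁ + b * t₄ * t₄))) ⊛ unit)
    (solve vars)

parametrised⇒commute : ∀ {a b ε g u v t₁ t₂ t₃ t₄} X Y → g ≢ 0ℤ → ε * ε ≡ 1ℤ →
  u * u + v * v * a * b ≡ + 4 → ParametrisedBy a b ε g u v t₁ t₂ t₃ t₄ X Y → CommutationEntries X Y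
parametrised⇒commute {a} {b} {ε} {g} {u} {v} {t₁} {t₂} {t₃} {t₄} (mat A B C D) (mat E F G H)
  g≢0 unit norm (refl , gB , gC , 2εD , refl , gF , gG , 2εH) =
  linear-combination-scaled g²≢0
    ((g * G) ⊛ gB ⊕ ((u - + 2 * ε) * t₂) ⊛ gG ⊕ (- (g * C)) ⊛ gF ⊕ (- (v * a * t₂)) ⊛ gC)
    (solve vars) ,
  linear-combination-scaled 2εg≢0
    ((+ 2 * ε * t₁ - + 2 * ε * D) ⊛ gF ⊕ (+ 2 * ε * H - + 2 * ε * t₄) ⊛ gB
     ⊕ ((u - + 2 * ε) * t₂) ⊛ 2εH ⊕ (- (v * a * t₂)) ⊛ 2εD
     ⊕ (- (t₂ * t₄)) ⊛ norm ⊕ (+ 4 * t₂ * t₄) ⊛ unit)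
    (solve vars) ,
  linear-combination-scaled 2εg≢0
    ((+ 2 * ε * t₄ - + 2 * ε * H) ⊛ gC ⊕ (+ 2 * ε * D - + 2 * ε * t₁) ⊛ gG
     ⊕ (v * a * t₃) ⊛ 2εD ⊕ (- ((u - + 2 * ε) * t₃)) ⊛ 2εH
     ⊕ (t₃ * t₄) ⊛ norm ⊕ (- (+ 4 * t₃ * t₄)) ⊛ unit)
    (solve vars) ,
  linear-combination-scaled g²≢0
    ((g * C) ⊛ gF ⊕ (v * a * t₂) ⊛ gC ⊕ (- (g * G)) ⊛ gB ⊕ (- ((u - + 2 * ε) * t₂)) ⊛ gG)
    (solve vars)
  where
  vars : List ℤ
  vars = a ∷ b ∷ ε ∷ g ∷ u ∷ v ∷ t₁ ∷ t₂ ∷ t₃ ∷ t₄ ∷ B ∷ C ∷ D ∷ F ∷ G ∷ H ∷ []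
  g²≢0 : g * g ≢ 0ℤ
  g²≢0 = *-≢0 g≢0 g≢0
  2ε≢0 : + 2 * ε ≢ 0ℤ
  2ε≢0 = *-≢0 {+ 2} (λ ()) (unit⇒≢0 unit)
  2εg≢0 : + 2 * ε * g ≢ 0ℤ
  2εg≢0 = *-≢0 2ε≢0 g≢0

cases⇒solution : ∀ {a b ε} X Y → ε * ε ≡ 1ℤ → Cases a b ε X Y → Solution a b ε X Y
cases⇒solution {a} {b} {ε} X Y unit (inj₁ (t₁ , t₂ , refl , refl , eq)) =
  both-scalar-solution {a} {b} {ε} {t₁} {t₂} eq
cases⇒solution {a} {b} {ε} X Y unit (inj₂ (inj₁ (t₁ , t₂ , t₃ , t₄ , refl , refl , eq))) =
  scalar-traceless-solution {a} {b} {ε} {t₁} {t₂} {t₃} {t₄} eq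
cases⇒solution {a} {b} {ε} X Y unit
  (inj₂ (inj₂ (t₁ , t₂ , t₃ , t₄ , u , v , u≢2ε , norm , constraint , parametrisation))) =
  entries⇒equation {a} {b} {ε} X Y
    (parametrised⇒equation {a} {b} {ε} {g} {u} {v} {t₁} {t₂} {t₃} {t₄} X Y
       g≢0 unit norm constraint parametrisation) ,
  entries⇒commute X Y
    (parametrised⇒commute {a} {b} {ε} {g} {u} {v} {t₁} {t₂} {t₃} {t₄} X Y g≢0 unit norm parametrisation)
  where
  g : ℤ
  g = gcd (v * a) (u - + 2 * ε)
  g≢0 : g ≢ 0ℤ
  g≢0 g≡0 = u≢2ε (i-j≡0⇒i≡j u (+ 2 * ε) (gcd[i,j]≡0⇒j≡0 {v * a} g≡0))

corollary4p2 : (a b ε : ℤ) → a ≢ 0ℤ → b ≢ 0ℤ → ¬ IsPerfectSquare (- (a * b))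
    → (ε ≡ 1ℤ ⊎ ε ≡ -1ℤ) → (X Y : M2)
    → ((a ·M (X *M X) +M b ·M (Y *M Y) ≡ (+ 2 * ε) ·M I) × (X *M Y ≡ Y *M X))
      ⇔ ((∃ λ t₁ → ∃ λ t₂ →
            X ≡ t₁ ·M I × Y ≡ t₂ ·M I
            × a * t₁ * t₁ + b * t₂ * t₂ ≡ + 2 * ε)
        ⊎ (∃ λ t₁ → ∃ λ t₂ → ∃ λ t₃ → ∃ λ t₄ →
            X ≡ t₁ ·M I × Y ≡ mat t₄ t₂ t₃ (- t₄)
            × a * t₁ * t₁ + b * (t₄ * t₄ + t₂ * t₃) ≡ + 2 * ε)
        ⊎ (∃ λ t₁ → ∃ λ t₂ → ∃ λ t₃ → ∃ λ t₄ → ∃ λ u → ∃ λ v →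
            let g = gcd (v * a) (u - + 2 * ε) in
            u ≢ + 2 * ε
            × u * u + v * v * a * b ≡ + 4
            × g * g * (a * t₁ * t₁ + b * t₄ * t₄) + + 4 * a * t₂ * t₃ * (+ 2 - ε * u)
                ≡ + 2 * ε * (g * g)
            × e₁₁ X ≡ t₁
            × g * e₁₂ X ≡ (u - + 2 * ε) * t₂
            × g * e₂₁ X ≡ (u - + 2 * ε) * t₃
            × + 2 * ε * e₂₂ X ≡ u * t₁ + v * b * t₄
            × e₁₁ Y ≡ t₄
            × g * e₁₂ Y ≡ v * a * t₂
            × g * e₂₁ Y ≡ v * a * t₃
            × + 2 * ε * e₂₂ Y ≡ v * a * t₁ - u * t₄))
corollary4p2 a b ε a≢0 b≢0 _ ε≡±1 X Y =
  mk⇔ (solution⇒cases {a} {b} {ε} X Y a≢0 b≢0 unit) (cases⇒solution {a} {b} {ε} X Y unit)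
  where
  unit : ε * ε ≡ 1ℤ
  unit = ±1⇒unit ε≡±1
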